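{- Fix $b\in\mathbb{N}$ and integers $M\ge2$, $N\ge2$. Let $P$ be the $b$-pattern consisting of the points $(r,s)$ with $1\le r\le M$, $1\le s\le N$, where the boundary points (those with $r\in\{1,M\}$ or $s\in\{1,N\}$) are assigned circles and all interior points (those with $1<r<M$ and $1<s<N$) are assigned crosses (all other points of the ambient box are assigned neither). For $b=1$, $P$ is realizable in $L$ if and only if $M$ and $N$ are both odd. For $b\ge2$, $P$ is realizable in $L$ if and only if $M$ is odd or $N<2^b$. In particular, for every $b$ there are arbitrarily large rectangular blocks of $b$-invisible points of $L$ whose boundary consists of $b$-visible points.
   Context: Let $\mathbb{N}=\{1,2,3,\dots\}$ and $L=\mathbb{N}\times\mathbb{N}$. For $b\in\mathbb{N}$, $\gcd_b(r,s)=\max\{k\in\mathbb{N}: k\mid r \text{ and } k^b\mid s\}$, and $(r,s)\in L$ is $b$-visible if $\gcd_b(r,s)=1$, $b$-invisible otherwise. A $b$-pattern is obtained by fixing a positive integer $w$ and assigning to each $(r,s)\in L$ with $1\le r\le w$, $1\le s\le w^b$ either a circle, a cross, or neither (here $w$ is any integer large enough that the rectangle fits, i.e. $w\ge M$ and $w^b\ge N$). A $b$-pattern is realizable in $L$ if there exists $(u,v)\in L$ such that $(u+r,v+s)$ is $b$-visible whenever $(r,s)$ is assigned a circle and $b$-invisible whenever $(r,s)$ is assigned a cross. -}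

module Defs where

open import Data.Nat using (ℕ; zero; suc; _+_; _*_; _^_; _≤_; _<_)
open import Data.Nat.Divisibility using (_∣_)
open import Data.Product using (Σ; _×_; ∃; _,_)
open import Relation.Binary.PropositionalEquality using (_≡_)
open import Data.Bool using (Bool; true; false; _∧_; _∨_; if_then_else_)
open import Data.Nat using (_≤ᵇ_; _<ᵇ_)

-- Positive naturals are encoded as ordinary ℕ together with explicit
-- positivity hypotheses where needed.

IsCommonDivisorB : ℕ → ℕ → ℕ → ℕ → Set
IsCommonDivisorB b r s k = (k ∣ r) × ((k ^ b) ∣ s)

-- gcd_b(r,s) = max { k ≥ 1 : k ∣ r, k^b ∣ s }.  (r,s) is b-visible iff this
-- maximum equals 1, i.e. (since 1 is always in the set) iff every positive
-- element of the set is ≤ 1.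
IsGcdB : ℕ → ℕ → ℕ → ℕ → Set
IsGcdB b r s g = (1 ≤ g) × IsCommonDivisorB b r s g
               × (∀ k → 1 ≤ k → IsCommonDivisorB b r s k → k ≤ g)

Visible : ℕ → ℕ → ℕ → Set
Visible b r s = IsGcdB b r s 1

Invisible : ℕ → ℕ → ℕ → Set
Invisible b r s = Visible b r s → Data.Empty.⊥
  where import Data.Empty

data Mark : Set where
  circle cross none : Mark

-- A b-pattern of width w: assigns a mark to each (r,s) with 1 ≤ r ≤ w,
-- 1 ≤ s ≤ w^b (values outside are ignored).
Pattern : Set
Pattern = ℕ → ℕ → Mark

Realizable : ℕ → ℕ → Pattern → Set
Realizable b w P = Σ ℕ λ u → Σ ℕ λ v →
  (∀ r s → 1 ≤ r → r ≤ w → 1 ≤ s → s ≤ w ^ b →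
     (P r s ≡ circle → Visible b (u + r) (v + s)) ×
     (P r s ≡ cross  → Invisible b (u + r) (v + s)))
  -- u , v ∈ ℕ = {1,2,...}
  × (1 ≤ u) × (1 ≤ v)

RectPattern : ℕ → ℕ → Pattern
RectPattern M N r s =
  if (1 ≤ᵇ r) ∧ (r ≤ᵇ M) ∧ (1 ≤ᵇ s) ∧ (s ≤ᵇ N)
  then (if (1 <ᵇ r) ∧ (r <ᵇ M) ∧ (1 <ᵇ s) ∧ (s <ᵇ N) then cross else circle)
  else none

Odd : ℕ → Set
Odd n = Σ ℕ λ k → n ≡ suc (2 * k)

-- "P is realizable in L": realizable for some (equivalently any) admissible
-- ambient width w with w ≥ M and w^b ≥ N.
RectRealizable : ℕ → ℕ → ℕ → Set
RectRealizable b M N =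
  Σ ℕ λ w → (M ≤ w) × (N ≤ w ^ b) × Realizable b w (RectPattern M N)

{-# OPTIONS --safe #-}

-- Sufficiency is a Chinese-remainder construction.  Each interior point (r, s) receives its
-- own prime p > M + N with p ∣ u + r and p ^ b ∣ v + s, so it is invisible; such a prime
-- cannot also hit a boundary point, because residues below p are unique.  Each prime
-- q ≤ M + N is given residues u ≡ -a (mod q), v ≡ -c (mod q ^ b) with a ∈ {0, 2} chosen
-- according to q ∣ M and c according to q ^ b ∣ N; then q meets the edges r ∈ {1, M} only
-- if q = 2 ∣ M, and q ^ b meets s ∈ {1, N} only if q ^ b = 2 ∣ N.  The first is excluded by
-- M odd, or by N < 2 ^ b (then 2 ^ b ∣ v, so 2 ^ b ∤ v + s), the second by N odd or b ≥ 2.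
-- Finally v is made divisible by every other prime dividing some u + r, which then could
-- only divide v + s by dividing s ≤ N, i.e. by being one of the small primes.
--
-- Necessity: if M is even, one of u + 1, u + M is even, and some 1 ≤ s ≤ 2 ^ b has
-- 2 ^ b ∣ v + s; if 2 ^ b ≤ N this is an invisible boundary point.  For b = 1 the same
-- argument applies to N.

module Submission where

open import Defs
open import Data.Nat using (ℕ; _≤_; _<_; _^_)
open import Data.Product using (_×_; Σ)
open import Data.Sum using (_⊎_)
open import Function.Bundles using (_⇔_)

open import Data.Bool using (Bool; if_then_else_; _∧_)
open import Data.Empty using (⊥; ⊥-elim)
open import Data.List using (List; []; _∷_; _++_; map; filter; upTo; cartesianProduct)
open import Data.List.Membership.Propositional using (_∈_)
open import Data.List.Membership.Propositional.Properties
  using (∈-map⁺; ∈-map⁻; ∈-++⁺ˡ; ∈-++⁺ʳ; ∈-++⁻; ∈-filter⁺; ∈-filter⁻; ∈-upTo⁺; ∈-upTo⁻;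
         ∈-cartesianProduct⁺)
open import Data.List.Relation.Unary.All using (All; []; _∷_)
import Data.List.Relation.Unary.All as All
import Data.List.Relation.Unary.All.Properties as All
open import Data.List.Relation.Unary.AllPairs using (AllPairs; []; _∷_)
import Data.List.Relation.Unary.AllPairs as AllPairs
import Data.List.Relation.Unary.AllPairs.Properties as AllPairs
open import Data.List.Relation.Unary.Any using (here; there)
open import Data.Nat
open import Data.Nat.Coprimality using (Coprime; coprime-Bézout; coprime-divisor)
  renaming (sym to coprime-sym)
open import Data.Nat.Divisibility
open import Data.Nat.DivMod using (_%_; _/_; m≡m%n+[m/n]*n; m%n<n)
open import Data.Nat.GCD using (module Bézout)
open import Data.Nat.ListAction using (product)
open import Data.Nat.ListAction.Properties using (∈⇒∣product)
open import Data.Nat.Primality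
  using (Prime; prime?; prime⇒nonZero; prime⇒nonTrivial; prime⇒irreducible; productOfPrimes≥1)
open import Data.Nat.Primality.Factorisation using (factorise)
open import Data.Nat.Properties
open import Algebra.Properties.CommutativeSemigroup +-commutativeSemigroup using (xy∙z≈xz∙y)
open import Data.Nat.Tactic.RingSolver using (solve-∀)
open import Data.Product using (_,_; proj₁; proj₂; ∃-syntax)
open import Data.Sum using (inj₁; inj₂; [_,_])
open import Function using (_on_; _∘_; id)
open import Function.Bundles using (mk⇔)
open import Relation.Binary.PropositionalEquality
  using (_≡_; _≢_; refl; cong; sym; trans; subst; subst₂; module ≡-Reasoning)
open import Relation.Nullary using (¬_; contradiction; yes; no; Dec)
open import Relation.Nullary.Decidable using (_×-dec_)
open import Relation.Nullary.Reflects using (Reflects; ofʸ; ofⁿ; _×-reflects_)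

open import Data.List.Membership.DecPropositional _≟_ using (_∈?_; _∉?_)

private variable
  b k m n o p q x y : ℕ

even-or-odd : ∀ n → 2 ∣ n ⊎ Odd n
even-or-odd zero = inj₁ (divides 0 refl)
even-or-odd (suc n) with even-or-odd n
... | inj₁ (divides k refl) = inj₂ (k , cong suc (*-comm k 2))
... | inj₂ (k , refl) = inj₁ (divides (suc k) (cong (2 +_) (*-comm 2 k)))

odd⇒¬2∣ : Odd n → ¬ 2 ∣ n
odd⇒¬2∣ (k , refl) 2∣n with () ← ∣1⇒≡1 (∣m+n∣m⇒∣n (subst (2 ∣_) (+-comm 1 (2 * k)) 2∣n) (m∣m*n k))

¬2∣⇒odd : ¬ 2 ∣ n → Odd n
¬2∣⇒odd {n} ¬2∣n with even-or-odd n
... | inj₁ 2∣n = contradiction 2∣n ¬2∣n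
... | inj₂ odd = odd

-- Coprimality and the Chinese remainder theorem

coprime-* : Coprime m n → Coprime m o → Coprime m (n * o)
coprime-* {m} {n} cmn cmo {d} (d∣m , d∣no) = cmo (d∣m , coprime-divisor coprime[d,n] d∣no)
  where
  coprime[d,n] : Coprime d n
  coprime[d,n] (e∣d , e∣n) = cmn (∣-trans e∣d d∣m , e∣n)

coprime-1 : Coprime m 1
coprime-1 (_ , d∣1) = ∣1⇒≡1 d∣1

coprime-product : ∀ {ns} → All (Coprime m) ns → Coprime m (product ns)
coprime-product [] = coprime-1
coprime-product (c ∷ cs) = coprime-* c (coprime-product cs)

coprime-^ʳ : ∀ k → Coprime m n → Coprime m (n ^ k)
coprime-^ʳ zero c = coprime-1
coprime-^ʳ (suc k) c = coprime-* c (coprime-^ʳ k c)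

coprime-^ : ∀ i j → Coprime m n → Coprime (m ^ i) (n ^ j)
coprime-^ i j c = coprime-^ʳ j (coprime-sym (coprime-^ʳ i (coprime-sym c)))

coprime⇒∃shift-to-multiple : 1 ≤ m → Coprime m n → ∀ c → ∃[ t ] m ∣ c + t * n
coprime⇒∃shift-to-multiple {suc m′} {n} _ cop c with coprime-Bézout cop
... | Bézout.+- x y eq = c * y , divides (c * x) (begin
  c + c * y * n       ≡⟨ distrib c y n ⟩
  c * (1 + y * n)     ≡⟨ cong (c *_) eq ⟩
  c * (x * suc m′)    ≡⟨ *-assoc c x (suc m′) ⟨
  c * x * suc m′      ∎)
  where
  open ≡-Reasoning
  distrib : ∀ c y n → c + c * y * n ≡ c * (1 + y * n)
  distrib = solve-∀
... | Bézout.-+ x y eq = c * m′ * y , divides (c + c * m′ * x) (begin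
  c + c * m′ * y * n          ≡⟨ cong (c +_) (*-assoc (c * m′) y n) ⟩
  c + c * m′ * (y * n)        ≡⟨ cong (λ z → c + c * m′ * z) eq ⟨
  c + c * m′ * (1 + x * suc m′) ≡⟨ distrib c m′ x ⟩
  (c + c * m′ * x) * suc m′   ∎)
  where
  open ≡-Reasoning
  distrib : ∀ c m′ x → c + c * m′ * (1 + x * suc m′) ≡ (c + c * m′ * x) * suc m′
  distrib = solve-∀

Solves : ℕ → List (ℕ × ℕ) → Set
Solves x = All (λ (m , a) → m ∣ x + a)

chinese-remainder : (system : List (ℕ × ℕ)) → All (λ (m , _) → 1 ≤ m) system →
      AllPairs (Coprime on proj₁) system → ∃[ x ] 1 ≤ x × Solves x system
chinese-remainder [] [] [] = 1 , ≤-refl , []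
chinese-remainder ((m , a) ∷ system) (1≤m ∷ pos) (cop ∷ cops) with chinese-remainder system pos cops
... | x₀ , 1≤x₀ , solves with coprime⇒∃shift-to-multiple 1≤m
                          (coprime-product (All.map⁺ cop)) (x₀ + a)
... | t , m∣ = x₀ + t * Π , ≤-trans 1≤x₀ (m≤m+n x₀ _) ,
               subst (m ∣_) (xy∙z≈xz∙y x₀ a (t * Π)) m∣ ∷ All.tabulate extend
  where
  Π = product (map proj₁ system)
  extend : ∀ {e} → e ∈ system → proj₁ e ∣ x₀ + t * Π + proj₂ e
  extend {e} e∈ = subst (proj₁ e ∣_) (xy∙z≈xz∙y x₀ (proj₂ e) (t * Π))
    (∣m∣n⇒∣m+n (All.lookup solves e∈) (∣n⇒∣m*n t (∈⇒∣product (∈-map⁺ proj₁ e∈))))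

prime⇒1< : Prime p → 1 < p
prime⇒1< {p} p-prime = nonTrivial⇒n>1 p {{prime⇒nonTrivial p-prime}}

prime≢1 : Prime p → p ≢ 1
prime≢1 p-prime = nonTrivial⇒≢1 {{prime⇒nonTrivial p-prime}}

prime≢⇒coprime : Prime p → Prime q → p ≢ q → Coprime p q
prime≢⇒coprime p-prime q-prime p≢q (d∣p , d∣q) with prime⇒irreducible p-prime d∣p
... | inj₁ d≡1 = d≡1
... | inj₂ refl with prime⇒irreducible q-prime d∣q
...   | inj₁ p≡1 = contradiction p≡1 (prime≢1 p-prime)
...   | inj₂ p≡q = contradiction p≡q p≢q

distinct-primes⇒coprime : ∀ {ps} → All Prime ps → AllPairs _≢_ ps → AllPairs Coprime ps
distinct-primes⇒coprime [] [] = []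
distinct-primes⇒coprime (p-prime ∷ primes) (p≢ ∷ distinct) =
  All.tabulate (λ q∈ → prime≢⇒coprime p-prime (All.lookup primes q∈) (All.lookup p≢ q∈))
  ∷ distinct-primes⇒coprime primes distinct

∃-prime-factor : 1 < n → ∃[ p ] Prime p × p ∣ n
∃-prime-factor {suc n} 1<n with factorise (suc n)
... | record { factors = [] ; isFactorisation = eq } = contradiction 1<n (<-irrefl (sym eq))
... | record { factors = p ∷ ps ; isFactorisation = eq ; factorsPrime = p-prime ∷ _ } =
  p , p-prime , subst (p ∣_) (sym eq) (∈⇒∣product {ns = p ∷ ps} (here refl))

m≤n⇒m∣n! : 1 ≤ m → m ≤ n → m ∣ n !
m≤n⇒m∣n! {suc m} _ m≤n = ∣-trans (m∣m*n (m !)) (m≤n⇒m!∣n! m≤n)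

∃-prime-above : ∀ n → ∃[ p ] Prime p × n < p
∃-prime-above n with ∃-prime-factor (s≤s (1≤n! n))
... | p , p-prime , p∣1+n! with n <? p
...   | yes n<p = p , p-prime , n<p
...   | no n≮p = contradiction (∣1⇒≡1 (∣m+n∣m⇒∣n p∣n!+1 p∣n!)) (prime≢1 p-prime)
  where
  p∣n!+1 : p ∣ n ! + 1
  p∣n!+1 = subst (p ∣_) (+-comm 1 (n !)) p∣1+n!
  p∣n! : p ∣ n !
  p∣n! = m≤n⇒m∣n! (<⇒≤ (prime⇒1< p-prime)) (≮⇒≥ n≮p)

primeAbove : ℕ → ℕ
primeAbove n = proj₁ (∃-prime-above n)

primeAbove-prime : ∀ n → Prime (primeAbove n)
primeAbove-prime n = proj₁ (proj₂ (∃-prime-above n))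

primeAbove-> : ∀ n → n < primeAbove n
primeAbove-> n = proj₂ (proj₂ (∃-prime-above n))

m∣m^n : 1 ≤ n → m ∣ m ^ n
m∣m^n {suc n} {m} _ = m∣m*n (m ^ n)

prime^n≥1 : ∀ n → Prime p → 1 ≤ p ^ n
prime^n≥1 {p} n p-prime = m^n>0 p {{prime⇒nonZero p-prime}} n

m≤m^n : ∀ m .{{_ : NonZero m}} → 1 ≤ n → m ≤ m ^ n
m≤m^n {n = n} m 1≤n = subst (_≤ m ^ n) (*-identityʳ m) (^-monoʳ-≤ m 1≤n)

2^b≤p^b : ∀ b → Prime p → 2 ^ b ≤ p ^ b
2^b≤p^b b p-prime = ^-monoˡ-≤ b (prime⇒1< p-prime)

primesUpTo : ℕ → List ℕ
primesUpTo n = filter prime? (upTo (suc n))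

∈-primesUpTo⁺ : Prime p → p ≤ n → p ∈ primesUpTo n
∈-primesUpTo⁺ p-prime p≤n = ∈-filter⁺ prime? (∈-upTo⁺ (s≤s p≤n)) p-prime

∈-primesUpTo⁻ : p ∈ primesUpTo n → p ≤ n
∈-primesUpTo⁻ p∈ = ≤-pred (∈-upTo⁻ (proj₁ (∈-filter⁻ prime? p∈)))

primesUpTo-prime : ∀ n → All Prime (primesUpTo n)
primesUpTo-prime n = All.all-filter prime? (upTo (suc n))

primesUpTo-sorted : ∀ n → AllPairs _<_ (primesUpTo n)
primesUpTo-sorted n = AllPairs.filter⁺ prime? (AllPairs.applyUpTo⁺₁ id (suc n) (λ i<j _ → i<j))

tagWithPrimesAbove : {A : Set} → ℕ → List A → List (ℕ × A)
tagWithPrimesAbove n [] = []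
tagWithPrimesAbove n (x ∷ xs) = (primeAbove n , x) ∷ tagWithPrimesAbove (primeAbove n) xs

module _ {A : Set} where

  ∈-tag⁺ : ∀ {n} {x : A} {xs} → x ∈ xs → ∃[ p ] (p , x) ∈ tagWithPrimesAbove n xs
  ∈-tag⁺ (here refl) = _ , here refl
  ∈-tag⁺ (there x∈) = let p , t∈ = ∈-tag⁺ x∈ in p , there t∈

  ∈-tag⁻ : ∀ {n} {t : ℕ × A} {xs} → t ∈ tagWithPrimesAbove n xs →
           Prime (proj₁ t) × n < proj₁ t × proj₂ t ∈ xs
  ∈-tag⁻ {n} {xs = _ ∷ _} (here refl) = primeAbove-prime n , primeAbove-> n , here refl
  ∈-tag⁻ {n} {xs = _ ∷ _} (there t∈) =
    let t-prime , bound , x∈ = ∈-tag⁻ t∈ in t-prime , <-trans (primeAbove-> n) bound , there x∈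

  tag-sorted : ∀ n (xs : List A) → AllPairs (_<_ on proj₁) (tagWithPrimesAbove n xs)
  tag-sorted n [] = []
  tag-sorted n (x ∷ xs) =
    All.tabulate (λ t∈ → proj₁ (proj₂ (∈-tag⁻ t∈))) ∷ tag-sorted (primeAbove n) xs

^-monoˡ-∣ : ∀ k → m ∣ n → m ^ k ∣ n ^ k
^-monoˡ-∣ zero _ = ∣-refl
^-monoˡ-∣ (suc k) m∣n = *-pres-∣ m∣n (^-monoˡ-∣ k m∣n)

visible-if-no-common-prime : (∀ {q} → Prime q → q ∣ x → q ^ b ∣ y → ⊥) → Visible b x y
visible-if-no-common-prime {x} {b} {y} no-prime =
  ≤-refl , (1∣ x , subst (_∣ y) (sym (^-zeroˡ b)) (1∣ y)) , maximal
  where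
  maximal : ∀ k → 1 ≤ k → IsCommonDivisorB b x y k → k ≤ 1
  maximal k _ (k∣x , k^b∣y) with k ≤? 1
  ... | yes k≤1 = k≤1
  ... | no k≰1 with ∃-prime-factor (≰⇒> k≰1)
  ...   | q , q-prime , q∣k =
    ⊥-elim (no-prime q-prime (∣-trans q∣k k∣x) (∣-trans (^-monoˡ-∣ b q∣k) k^b∣y))

invisible-if-common-factor : 1 < k → k ∣ x → k ^ b ∣ y → Invisible b x y
invisible-if-common-factor {k} 1<k k∣x k^b∣y (_ , _ , maximal) =
  <⇒≱ 1<k (maximal k (<⇒≤ 1<k) (k∣x , k^b∣y))

InRectangle : ℕ → ℕ → ℕ → ℕ → Set
InRectangle M N r s = 1 ≤ r × r ≤ M × 1 ≤ s × s ≤ N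

Interior : ℕ → ℕ → ℕ → ℕ → Set
Interior M N r s = 1 < r × r < M × 1 < s × s < N

interior? : ∀ M N (x : ℕ × ℕ) → Dec (Interior M N (proj₁ x) (proj₂ x))
interior? M N (r , s) = 1 <? r ×-dec r <? M ×-dec 1 <? s ×-dec s <? N

Edge : ℕ → ℕ → Set
Edge k t = t ≡ 1 ⊎ t ≡ k

OnBoundary : ℕ → ℕ → ℕ → ℕ → Set
OnBoundary M N r s = Edge M r ⊎ Edge N s

onBoundary⇒¬interior : ∀ {M N r s} → OnBoundary M N r s → ¬ Interior M N r s
onBoundary⇒¬interior (inj₁ (inj₁ refl)) (1<1 , _)         = <-irrefl refl 1<1
onBoundary⇒¬interior (inj₁ (inj₂ refl)) (_ , M<M , _)     = <-irrefl refl M<M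
onBoundary⇒¬interior (inj₂ (inj₁ refl)) (_ , _ , 1<1 , _) = <-irrefl refl 1<1
onBoundary⇒¬interior (inj₂ (inj₂ refl)) (_ , _ , _ , N<N) = <-irrefl refl N<N

¬interior⇒onBoundary : ∀ {M N r s} → InRectangle M N r s → ¬ Interior M N r s → OnBoundary M N r s
¬interior⇒onBoundary {M} {N} {r} {s} (1≤r , r≤M , 1≤s , s≤N) ¬interior
  with 1 ≟ r | r ≟ M | 1 ≟ s | s ≟ N
... | yes refl | _        | _        | _        = inj₁ (inj₁ refl)
... | _        | yes refl | _        | _        = inj₁ (inj₂ refl)
... | _        | _        | yes refl | _        = inj₂ (inj₁ refl)
... | _        | _        | _        | yes refl = inj₂ (inj₂ refl)
... | no 1≢r   | no r≢M   | no 1≢s   | no s≢N   = contradiction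
  (≤∧≢⇒< 1≤r 1≢r , ≤∧≢⇒< r≤M r≢M , ≤∧≢⇒< 1≤s 1≢s , ≤∧≢⇒< s≤N s≢N) ¬interior

module _ {M N r s : ℕ} where

  private
    inRectangle-reflects :
      Reflects (InRectangle M N r s) ((1 ≤ᵇ r) ∧ (r ≤ᵇ M) ∧ (1 ≤ᵇ s) ∧ (s ≤ᵇ N))
    inRectangle-reflects = ≤ᵇ-reflects-≤ 1 r ×-reflects ≤ᵇ-reflects-≤ r M
                           ×-reflects ≤ᵇ-reflects-≤ 1 s ×-reflects ≤ᵇ-reflects-≤ s N

    interior-reflects :
      Reflects (Interior M N r s) ((1 <ᵇ r) ∧ (r <ᵇ M) ∧ (1 <ᵇ s) ∧ (s <ᵇ N))
    interior-reflects = <ᵇ-reflects-< 1 r ×-reflects <ᵇ-reflects-< r M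
                        ×-reflects <ᵇ-reflects-< 1 s ×-reflects <ᵇ-reflects-< s N

    Nested : Bool → Bool → Mark
    Nested a c = if a then (if c then cross else circle) else none

    nested-circle⁻ : ∀ {A C : Set} {a c} → Reflects A a → Reflects C c →
                     Nested a c ≡ circle → A × ¬ C
    nested-circle⁻ (ofʸ x) (ofⁿ ¬z) refl = x , ¬z

    nested-circle⁺ : ∀ {A C : Set} {a c} → Reflects A a → Reflects C c →
                     A → ¬ C → Nested a c ≡ circle
    nested-circle⁺ (ofʸ _) (ofⁿ _) _ _ = refl
    nested-circle⁺ (ofʸ _) (ofʸ z) _ ¬z = contradiction z ¬z
    nested-circle⁺ (ofⁿ ¬x) _ x _ = contradiction x ¬x

    nested-cross⁻ : ∀ {A C : Set} {a c} → Reflects A a → Reflects C c → Nested a c ≡ cross → C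
    nested-cross⁻ (ofʸ _) (ofʸ z) refl = z

  rect-circle⁻ : RectPattern M N r s ≡ circle → InRectangle M N r s × ¬ Interior M N r s
  rect-circle⁻ = nested-circle⁻ inRectangle-reflects interior-reflects

  rect-circle⁺ : InRectangle M N r s → ¬ Interior M N r s → RectPattern M N r s ≡ circle
  rect-circle⁺ = nested-circle⁺ inRectangle-reflects interior-reflects

  rect-cross⁻ : RectPattern M N r s ≡ cross → Interior M N r s
  rect-cross⁻ = nested-cross⁻ inRectangle-reflects interior-reflects

-- Residues and edge shifts

∃-shift-to-multiple : ∀ d .{{_ : NonZero d}} x → ∃[ t ] 1 ≤ t × t ≤ d × d ∣ x + t
∃-shift-to-multiple d x =
  d ∸ ρ , m<n⇒0<n∸m ρ<d , m∸n≤m d ρ , divides (suc (x / d)) (begin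
    x + (d ∸ ρ)           ≡⟨ cong (_+ (d ∸ ρ)) (m≡m%n+[m/n]*n x d) ⟩
    ρ + x / d * d + (d ∸ ρ) ≡⟨ cong (_+ (d ∸ ρ)) (+-comm ρ _) ⟩
    x / d * d + ρ + (d ∸ ρ) ≡⟨ +-assoc (x / d * d) ρ _ ⟩
    x / d * d + (ρ + (d ∸ ρ)) ≡⟨ cong (x / d * d +_) (m+[n∸m]≡n (<⇒≤ ρ<d)) ⟩
    x / d * d + d           ≡⟨ +-comm (x / d * d) d ⟩
    suc (x / d) * d         ∎)
  where
  open ≡-Reasoning
  ρ = x % d
  ρ<d : ρ < d
  ρ<d = m%n<n x d

∣∧<⇒≡0 : ∀ {d} → d ∣ n → n < d → n ≡ 0
∣∧<⇒≡0 {zero}  _   _   = refl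
∣∧<⇒≡0 {suc n} d∣n n<d = contradiction (∣⇒≤ d∣n) (<⇒≱ n<d)

residue-unique-≤ : ∀ {d a a′} → a ≤ a′ → a′ < d → d ∣ x + a → d ∣ x + a′ → a ≡ a′
residue-unique-≤ {x} {d} {a} {a′} a≤a′ a′<d d∣x+a d∣x+a′ =
  ≤-antisym a≤a′ (m∸n≡0⇒m≤n (∣∧<⇒≡0 d∣a′∸a (≤-<-trans (m∸n≤m a′ a) a′<d)))
  where
  d∣a′∸a : d ∣ a′ ∸ a
  d∣a′∸a = ∣m+n∣m⇒∣n (subst (d ∣_) split d∣x+a′) d∣x+a
    where
    split : x + a′ ≡ x + a + (a′ ∸ a)
    split = trans (cong (x +_) (sym (m+[n∸m]≡n a≤a′))) (sym (+-assoc x a (a′ ∸ a)))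

residue-unique : ∀ {d a a′} → a < d → a′ < d → d ∣ x + a → d ∣ x + a′ → a ≡ a′
residue-unique {a = a} {a′} a<d a′<d d∣x+a d∣x+a′ with ≤-total a a′
... | inj₁ a≤a′ = residue-unique-≤ a≤a′ a′<d d∣x+a d∣x+a′
... | inj₂ a′≤a = sym (residue-unique-≤ a′≤a a<d d∣x+a′ d∣x+a)

edgeShift : ℕ → ℕ → ℕ
edgeShift k d with d ∣? k
... | yes _ = 2
... | no  _ = 0

edgeShift-collision : ∀ {d t} → d ∣ x + edgeShift k d → d ∣ x + t → Edge k t → d ∣ 2 × d ∣ k
edgeShift-collision {x} {k} {d} d∣x+e d∣x+t t∈edge with d ∣? k | t∈edge
... | yes d∣k | inj₁ refl = ∣-trans d∣1 (1∣ 2) , d∣k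
  where d∣1 = ∣m+n∣m⇒∣n (subst (d ∣_) (sym (+-assoc x 1 1)) d∣x+e) d∣x+t
... | yes d∣k | inj₂ refl = ∣m+n∣m⇒∣n d∣x+e d∣x , d∣k
  where d∣x = ∣m+n∣m⇒∣n (subst (d ∣_) (+-comm x k) d∣x+t) d∣k
... | no _    | inj₁ refl = ∣-trans d∣1 (1∣ 2) , ∣-trans d∣1 (1∣ k)
  where d∣1 = ∣m+n∣m⇒∣n d∣x+t (subst (d ∣_) (+-identityʳ x) d∣x+e)
... | no d∤k  | inj₂ refl = contradiction (∣m+n∣m⇒∣n d∣x+t (subst (d ∣_) (+-identityʳ x) d∣x+e)) d∤k

edgeShift-no-collision : ∀ {d t} → 1 ≤ t → t ≤ k → k < d → d ∣ x + edgeShift k d → ¬ d ∣ x + t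
edgeShift-no-collision {k} {x} {d} {t} 1≤t t≤k k<d d∣x+e d∣x+t with d ∣? k
... | yes d∣k = <⇒≱ k<d (∣⇒≤ {{>-nonZero (≤-trans 1≤t t≤k)}} d∣k)
... | no  _   = <⇒≱ (≤-<-trans t≤k k<d)
                    (∣⇒≤ {{>-nonZero 1≤t}} (∣m+n∣m⇒∣n d∣x+t (subst (d ∣_) (+-identityʳ x) d∣x+e)))

edgeShift-avoids-left-right : ∀ {M N r s u v} → Odd M ⊎ N < 2 ^ b → Prime q → 1 ≤ s → s ≤ N →
  q ∣ u + edgeShift M q → q ^ b ∣ v + edgeShift N (q ^ b) → q ∣ u + r → q ^ b ∣ v + s →
  ¬ Edge M r
edgeShift-avoids-left-right width q-prime 1≤s s≤N q∣u+e q^b∣v+e q∣u+r q^b∣v+s r∈edge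
  with edgeShift-collision q∣u+e q∣u+r r∈edge
... | q∣2 , q∣M with ≤-antisym (∣⇒≤ q∣2) (prime⇒1< q-prime) | width
...   | refl | inj₁ odd-M = odd⇒¬2∣ odd-M q∣M
...   | refl | inj₂ N<2^b = edgeShift-no-collision 1≤s s≤N N<2^b q^b∣v+e q^b∣v+s

edgeShift-avoids-bottom-top : ∀ {N s v} → 1 ≤ b → Odd N ⊎ 2 ≤ b → Prime q →
  q ^ b ∣ v + edgeShift N (q ^ b) → q ^ b ∣ v + s → ¬ Edge N s
edgeShift-avoids-bottom-top {b} {q} {N} 1≤b height q-prime q^b∣v+e q^b∣v+s s∈edge
  with edgeShift-collision q^b∣v+e q^b∣v+s s∈edge | height
... | q^b∣2 , q^b∣N | inj₁ odd-N = odd⇒¬2∣ odd-N (subst (_∣ N) q^b≡2 q^b∣N)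
  where
  q^b≡2 : q ^ b ≡ 2
  q^b≡2 = ≤-antisym (∣⇒≤ q^b∣2) (≤-trans (^-monoʳ-≤ 2 1≤b) (2^b≤p^b b q-prime))
... | q^b∣2 , _ | inj₂ 2≤b =
  contradiction (≤-trans (≤-trans (^-monoʳ-≤ 2 2≤b) (2^b≤p^b b q-prime)) (∣⇒≤ q^b∣2))
                λ { (s≤s (s≤s ())) }

edgeShift-avoids-boundary : ∀ {M N r s u v} → 1 ≤ b → Odd M ⊎ N < 2 ^ b → Odd N ⊎ 2 ≤ b →
  Prime q → InRectangle M N r s → OnBoundary M N r s →
  q ∣ u + edgeShift M q → q ^ b ∣ v + edgeShift N (q ^ b) → q ∣ u + r → q ^ b ∣ v + s → ⊥
edgeShift-avoids-boundary {b = b} 1≤b width height q-prime (_ , _ , 1≤s , s≤N)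
  onB q∣u+e q^b∣v+e q∣u+r q^b∣v+s =
  [ edgeShift-avoids-left-right {b = b} width q-prime 1≤s s≤N q∣u+e q^b∣v+e q∣u+r q^b∣v+s
  , edgeShift-avoids-bottom-top 1≤b height q-prime q^b∣v+e q^b∣v+s
  ] onB

-- Realizing the pattern

module Construction (b M N : ℕ) (1≤b : 1 ≤ b) where

  bound : ℕ
  bound = M + N

  -- (p , a , c) asks for p ∣ u + a and p ^ b ∣ v + c
  Target : Set
  Target = ℕ × ℕ × ℕ

  smallTargets : List Target
  smallTargets = map (λ q → q , edgeShift M q , edgeShift N (q ^ b)) (primesUpTo bound)

  interiorPoints : List (ℕ × ℕ)
  interiorPoints = filter (interior? M N) (cartesianProduct (upTo M) (upTo N))

  largeTargets : List Target
  largeTargets = tagWithPrimesAbove bound interiorPoints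

  targets : List Target
  targets = smallTargets ++ largeTargets

  primes : List ℕ
  primes = map proj₁ targets

  primes-prime : All Prime primes
  primes-prime = All.map⁺ (All.++⁺ (All.map⁺ (primesUpTo-prime bound))
                                    (All.tabulate (λ t∈ → proj₁ (∈-tag⁻ t∈))))

  primes-coprime : AllPairs Coprime primes
  primes-coprime = distinct-primes⇒coprime primes-prime (AllPairs.map <⇒≢ (AllPairs.map⁺
    (AllPairs.++⁺ (AllPairs.map⁺ (primesUpTo-sorted bound)) (tag-sorted bound interiorPoints)
                  (All.map⁺ (All.tabulate small<large)))))
    where
    small<large : ∀ {q} → q ∈ primesUpTo bound → All (λ t → q < proj₁ t) largeTargets
    small<large q∈ = All.tabulate (λ t∈ → ≤-<-trans (∈-primesUpTo⁻ q∈) (proj₁ (proj₂ (∈-tag⁻ t∈))))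

  rowSystem : List (ℕ × ℕ)
  rowSystem = map (λ (p , a , _) → p , a) targets

  rowSolution : ∃[ x ] 1 ≤ x × Solves x rowSystem
  rowSolution = chinese-remainder rowSystem
    (All.map⁺ (All.map (<⇒≤ ∘ prime⇒1<) (All.map⁻ primes-prime)))
    (AllPairs.map⁺ (AllPairs.map⁻ primes-coprime))

  opaque
    u : ℕ
    u = proj₁ rowSolution

    1≤u : 1 ≤ u
    1≤u = proj₁ (proj₂ rowSolution)

    u-placed : ∀ {p a c} → (p , a , c) ∈ targets → p ∣ u + a
    u-placed = All.lookup (All.map⁻ (proj₂ (proj₂ rowSolution)))

  -- contains every non-target prime dividing some u + r with 1 ≤ r ≤ M
  otherPrimes : List ℕ
  otherPrimes = filter (_∉? primes) (primesUpTo (u + M))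

  D : ℕ
  D = product otherPrimes

  D-coprime : p ∈ primes → Coprime D (p ^ b)
  D-coprime {p} p∈ = coprime-^ʳ b (coprime-sym (coprime-product (All.tabulate coprime-to-p)))
    where
    coprime-to-p : ∀ {q} → q ∈ otherPrimes → Coprime p q
    coprime-to-p q∈ with ∈-filter⁻ (_∉? primes) q∈
    ... | q∈primesUpTo , q∉ = prime≢⇒coprime (All.lookup primes-prime p∈)
      (All.lookup (primesUpTo-prime (u + M)) q∈primesUpTo) (λ { refl → q∉ p∈ })

  columnSystem : List (ℕ × ℕ)
  columnSystem = (D , 0) ∷ map (λ (p , _ , c) → p ^ b , c) targets

  columnSolution : ∃[ x ] 1 ≤ x × Solves x columnSystem
  columnSolution = chinese-remainder columnSystem
    (productOfPrimes≥1 (All.filter⁺ (_∉? primes) (primesUpTo-prime (u + M)))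
      ∷ All.map⁺ (All.map (prime^n≥1 b) (All.map⁻ primes-prime)))
    (All.map⁺ (All.tabulate (λ t∈ → D-coprime (∈-map⁺ proj₁ t∈)))
      ∷ AllPairs.map⁺ (AllPairs.map⁻ (AllPairs.map (coprime-^ b b) primes-coprime)))

  opaque
    v : ℕ
    v = proj₁ columnSolution

    1≤v : 1 ≤ v
    1≤v = proj₁ (proj₂ columnSolution)

    v-placed : ∀ {p a c} → (p , a , c) ∈ targets → p ^ b ∣ v + c
    v-placed = All.lookup (All.map⁻ (All.tail (proj₂ (proj₂ columnSolution))))

    D∣v : D ∣ v
    D∣v = subst (D ∣_) (+-identityʳ v) (All.head (proj₂ (proj₂ columnSolution)))

  interior-invisible : ∀ {r s} → Interior M N r s → Invisible b (u + r) (v + s)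
  interior-invisible interior@(_ , r<M , _ , s<N)
    with ∈-tag⁺ {n = bound} (∈-filter⁺ (interior? M N)
           (∈-cartesianProduct⁺ (∈-upTo⁺ r<M) (∈-upTo⁺ s<N)) interior)
  ... | p , t∈ = invisible-if-common-factor {b = b} (prime⇒1< (proj₁ (∈-tag⁻ t∈)))
                   (u-placed t∈′) (v-placed t∈′)
    where t∈′ = ∈-++⁺ʳ smallTargets t∈

  common-prime-listed : ∀ {r s} → Prime q → q ∣ u + r → q ^ b ∣ v + s →
                        InRectangle M N r s → q ∈ primes
  common-prime-listed {q} {r} {s} q-prime q∣u+r q^b∣v+s (1≤r , r≤M , 1≤s , s≤N)
    with q ∈? primes
  ... | yes q∈ = q∈
  ... | no  q∉ = ∈-map⁺ proj₁ (∈-++⁺ˡ (∈-map⁺ _ (∈-primesUpTo⁺ q-prime q≤bound)))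
    where
    q≤u+M : q ≤ u + M
    q≤u+M = ≤-trans (∣⇒≤ {{>-nonZero (≤-trans 1≤r (m≤n+m r u))}} q∣u+r) (+-monoʳ-≤ u r≤M)
    q∣D : q ∣ D
    q∣D = ∈⇒∣product (∈-filter⁺ (_∉? primes) (∈-primesUpTo⁺ q-prime q≤u+M) q∉)
    q∣s : q ∣ s
    q∣s = ∣m+n∣m⇒∣n (∣-trans (m∣m^n 1≤b) q^b∣v+s) (∣-trans q∣D D∣v)
    q≤bound : q ≤ bound
    q≤bound = ≤-trans (∣⇒≤ {{>-nonZero 1≤s}} q∣s) (≤-trans s≤N (m≤n+m N M))

  large-target-off-boundary : ∀ {q a c r s} → (q , a , c) ∈ largeTargets → InRectangle M N r s →
    q ∣ u + r → q ^ b ∣ v + s → ¬ OnBoundary M N r s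
  large-target-off-boundary t∈ (_ , r≤M , _ , s≤N) q∣u+r q^b∣v+s onB
    with ∈-tag⁻ t∈ | ∈-++⁺ʳ smallTargets t∈
  ... | _ , bound<q , a,c∈ | t∈′
    with proj₂ (∈-filter⁻ (interior? M N) {xs = cartesianProduct (upTo M) (upTo N)} a,c∈)
  ...   | interior@(_ , a<M , _ , c<N) = onBoundary⇒¬interior onB
    (subst₂ (Interior M N) a≡r c≡s interior)
    where
    a≡r = residue-unique (<-trans (<-≤-trans a<M (m≤m+n M N)) bound<q)
                         (≤-<-trans r≤M (≤-<-trans (m≤m+n M N) bound<q)) (u-placed t∈′) q∣u+r
    c≡s = residue-unique (<-trans (<-≤-trans c<N (m≤n+m N M)) bound<q)
                         (≤-<-trans s≤N (≤-<-trans (m≤n+m N M) bound<q))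
                         (∣-trans (m∣m^n 1≤b) (v-placed t∈′)) (∣-trans (m∣m^n 1≤b) q^b∣v+s)

  boundary-visible : ∀ {r s} → Odd M ⊎ N < 2 ^ b → Odd N ⊎ 2 ≤ b →
    InRectangle M N r s → OnBoundary M N r s → Visible b (u + r) (v + s)
  boundary-visible {r} {s} width height inR onB = visible-if-no-common-prime {b = b} no-common-prime
    where
    no-common-prime : ∀ {q} → Prime q → q ∣ u + r → q ^ b ∣ v + s → ⊥
    no-common-prime q-prime q∣u+r q^b∣v+s
      with ∈-map⁻ proj₁ (common-prime-listed q-prime q∣u+r q^b∣v+s inR)
    ... | (q , a , c) , t∈ , refl with ∈-++⁻ smallTargets t∈
    ...   | inj₂ large = large-target-off-boundary large inR q∣u+r q^b∣v+s onB
    ...   | inj₁ small with ∈-map⁻ _ small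
    ...     | _ , _ , refl = edgeShift-avoids-boundary 1≤b width height q-prime inR onB
                                (u-placed t∈) (v-placed t∈) q∣u+r q^b∣v+s

rect-realizable : ∀ b {M N} → 1 ≤ b → Odd M ⊎ N < 2 ^ b → Odd N ⊎ 2 ≤ b → RectRealizable b M N
rect-realizable b {M} {N} 1≤b width height =
  w , ≤-trans (m≤m+n M N) (n≤1+n _) , ≤-trans (≤-trans (m≤n+m N M) (n≤1+n _)) (m≤m^n w 1≤b) ,
  u , v , marks , 1≤u , 1≤v
  where
  open Construction b M N 1≤b
  w = suc (M + N)
  marks : ∀ r s → 1 ≤ r → r ≤ w → 1 ≤ s → s ≤ w ^ b →
          (RectPattern M N r s ≡ circle → Visible b (u + r) (v + s)) ×
          (RectPattern M N r s ≡ cross → Invisible b (u + r) (v + s))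
  marks r s _ _ _ _ =
    (λ is-circle → let inR , ¬interior = rect-circle⁻ is-circle in
                   boundary-visible width height inR (¬interior⇒onBoundary inR ¬interior)) ,
    (λ is-cross → interior-invisible (rect-cross⁻ is-cross))

-- Obstructions

boundary-visible-of-realizable : ∀ {M N} → RectRealizable b M N → ∃[ u ] ∃[ v ]
  (∀ {r s} → InRectangle M N r s → OnBoundary M N r s → Visible b (u + r) (v + s))
boundary-visible-of-realizable {b} {M} {N} (w , M≤w , N≤w^b , u , v , marks , _) = u , v , visible
  where
  visible : ∀ {r s} → InRectangle M N r s → OnBoundary M N r s → Visible b (u + r) (v + s)
  visible {r} {s} inR@(1≤r , r≤M , 1≤s , s≤N) onB =
    proj₁ (marks r s 1≤r (≤-trans r≤M M≤w) 1≤s (≤-trans s≤N N≤w^b))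
          (rect-circle⁺ inR (onBoundary⇒¬interior onB))

even⇒∃edge-multiple : 2 ∣ k → ∀ x → ∃[ t ] Edge k t × 2 ∣ x + t
even⇒∃edge-multiple {k} 2∣k x with ∃-shift-to-multiple 2 x
... | 1 , _ , _ , 2∣x+1 = 1 , inj₁ refl , 2∣x+1
... | 2 , _ , _ , 2∣x+2 = k , inj₂ refl , ∣m∣n⇒∣m+n 2∣x 2∣k
  where 2∣x = ∣m+n∣m⇒∣n (subst (2 ∣_) (+-comm x 2) 2∣x+2) ∣-refl
... | suc (suc (suc _)) , _ , s≤s (s≤s ()) , _

edge-in-range : ∀ {t} → 1 ≤ k → Edge k t → 1 ≤ t × t ≤ k
edge-in-range 1≤k (inj₁ refl) = ≤-refl , 1≤k
edge-in-range 1≤k (inj₂ refl) = 1≤k , ≤-refl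

even-width⇒¬realizable : ∀ b {M N} → 1 ≤ M → 2 ∣ M → 2 ^ b ≤ N → ¬ RectRealizable b M N
even-width⇒¬realizable b 1≤M 2∣M 2^b≤N realizable
  with boundary-visible-of-realizable {b = b} realizable
... | u , v , visible
  with even⇒∃edge-multiple 2∣M u | ∃-shift-to-multiple (2 ^ b) {{m^n≢0 2 b}} v
... | r , r∈edge , 2∣u+r | s , 1≤s , s≤2^b , 2^b∣v+s =
  let 1≤r , r≤M = edge-in-range 1≤M r∈edge in
  invisible-if-common-factor {b = b} ≤-refl 2∣u+r 2^b∣v+s
    (visible (1≤r , r≤M , 1≤s , ≤-trans s≤2^b 2^b≤N) (inj₁ r∈edge))

even-height⇒¬realizable₁ : ∀ {M N} → 2 ≤ M → 1 ≤ N → 2 ∣ N → ¬ RectRealizable 1 M N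
even-height⇒¬realizable₁ 2≤M 1≤N 2∣N realizable
  with boundary-visible-of-realizable {b = 1} realizable
... | u , v , visible with ∃-shift-to-multiple 2 u | even⇒∃edge-multiple 2∣N v
... | r , 1≤r , r≤2 , 2∣u+r | s , s∈edge , 2∣v+s =
  let 1≤s , s≤N = edge-in-range 1≤N s∈edge in
  invisible-if-common-factor {b = 1} ≤-refl 2∣u+r 2∣v+s
    (visible (1≤r , ≤-trans r≤2 2≤M , 1≤s , s≤N) (inj₂ s∈edge))

realizable₁⇔odd : ∀ M N → 2 ≤ M → 2 ≤ N → RectRealizable 1 M N ⇔ (Odd M × Odd N)
realizable₁⇔odd M N 2≤M 2≤N = mk⇔
  (λ realizable →
    ¬2∣⇒odd (λ 2∣M → even-width⇒¬realizable 1 (<⇒≤ 2≤M) 2∣M 2≤N realizable) ,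
    ¬2∣⇒odd (λ 2∣N → even-height⇒¬realizable₁ 2≤M (<⇒≤ 2≤N) 2∣N realizable))
  (λ (odd-M , odd-N) → rect-realizable 1 ≤-refl (inj₁ odd-M) (inj₁ odd-N))

realizable⇔odd-or-short : ∀ b M N → 2 ≤ b → 1 ≤ M → RectRealizable b M N ⇔ (Odd M ⊎ N < 2 ^ b)
realizable⇔odd-or-short b M N 2≤b 1≤M =
  mk⇔ necessary (λ shape → rect-realizable b (<⇒≤ 2≤b) shape (inj₂ 2≤b))
  where
  necessary : RectRealizable b M N → Odd M ⊎ N < 2 ^ b
  necessary realizable with N <? 2 ^ b
  ... | yes N<2^b = inj₂ N<2^b
  ... | no  N≮2^b = inj₁ (¬2∣⇒odd λ 2∣M → even-width⇒¬realizable b 1≤M 2∣M (≮⇒≥ N≮2^b) realizable)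

∃-large-realizable : ∀ b n → 1 ≤ b →
  Σ ℕ λ M → Σ ℕ λ N → n ≤ M × n ≤ N × 2 ≤ M × 2 ≤ N × RectRealizable b M N
∃-large-realizable b n 1≤b = K , K , n≤K , n≤K , 2≤K , 2≤K ,
                             rect-realizable b 1≤b (inj₁ (suc n , refl)) (inj₁ (suc n , refl))
  where
  K = suc (2 * suc n)
  n≤K : n ≤ K
  n≤K = ≤-trans (n≤1+n n) (≤-trans (m≤m+n (suc n) _) (n≤1+n _))
  2≤K : 2 ≤ K
  2≤K = s≤s (s≤s z≤n)

mainTheorem9 :
    ((M N : ℕ) → 2 ≤ M → 2 ≤ N →
       (RectRealizable 1 M N ⇔ (Odd M × Odd N)))
    × ((b M N : ℕ) → 2 ≤ b → 2 ≤ M → 2 ≤ N →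
       (RectRealizable b M N ⇔ (Odd M ⊎ N < 2 ^ b)))
    × ((b n : ℕ) → 1 ≤ b →
       Σ ℕ λ M → Σ ℕ λ N → n ≤ M × n ≤ N × 2 ≤ M × 2 ≤ N × RectRealizable b M N)
mainTheorem9 =
  realizable₁⇔odd ,
  (λ b M N 2≤b 2≤M _ → realizable⇔odd-or-short b M N 2≤b (<⇒≤ 2≤M)) ,
  ∃-large-realizable
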